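{- Let $A$ be an alphabet and $x\in A$. Then for any words $w_1$ and $w_2$ over $A$, $x\neq w_1w_2$.
   Context: Work in a two-sorted first-order theory with equality whose sorts are words (lower-case variables) and systems (upper-case variables), with two word constants $0$ and $1$, a binary concatenation operation on words written by juxtaposition, and a membership relation $x\in S$ between a word and a system. Axioms: (symbols) $0\neq 1$ and $xy\neq 0$, $xy\neq 1$ for all words $x,y$; (associativity) $(xy)z=x(yz)$; (reading) $x0\neq y1$ for all $x,y$; (simplification) if $x_1y_1=x_2y_2$ and $y_1=y_2$ then $x_1=x_2$; (extensionality) two systems with the same elements are equal; (word induction) every system containing $0$ and $1$ and containing $x0$ and $x1$ whenever it contains $x$ contains every word; (comprehension) for every formula $\phi(x,x_1,\dots,x_n,S_1,\dots,S_m)$ in which $S$ is not free, there is a system $S$ with $x\in S\Leftrightarrow\phi$ for all words $x$. A system $A$ is an alphabet if for all words $x,y$ and all $z_1,z_2\in A$, $xz_1=yz_2$ implies $z_1=z_2$, and $z_1x=z_2y$ implies $z_1=z_2$. The words over a system $A$ are the elements of the system right-generated by $A$, i.e. the smallest system containing every element of $A$ and containing $x_2x_1$ whenever $x_1\in A$ and $x_2$ belongs to it. -}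

module Defs where

open import Level using (Level; suc; _⊔_) renaming (zero to lzero)
open import Data.Nat using (ℕ) renaming (suc to sucℕ)
open import Data.Fin using (Fin) renaming (zero to fz; suc to fs)
open import Data.Product using (Σ; _×_; _,_)
open import Data.Sum using (_⊎_)
open import Data.Empty using (⊥)
open import Relation.Nullary using (¬_)
open import Relation.Binary.PropositionalEquality using (_≡_)
open import Function.Bundles using (_⇔_)

-- Syntax of first-order formulas of the two-sorted language
-- (nw free word variables, ns free system variables, de Bruijn style).

data Term (nw : ℕ) : Set where
  var  : Fin nw → Term nw
  𝟘 𝟙  : Term nw
  _·_  : Term nw → Term nw → Term nw

data Formula (nw ns : ℕ) : Set where
  _≐_     : Term nw → Term nw → Formula nw ns
  _∈ₛ_    : Term nw → Fin ns → Formula nw ns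
  _≐ₛ_    : Fin ns → Fin ns → Formula nw ns
  ⊥f      : Formula nw ns
  _∧f_ _∨f_ _⇒f_ : Formula nw ns → Formula nw ns → Formula nw ns
  ¬f_     : Formula nw ns → Formula nw ns
  ∀w ∃w   : Formula (sucℕ nw) ns → Formula nw ns
  ∀s ∃s   : Formula nw (sucℕ ns) → Formula nw ns

extend : ∀ {a} {A : Set a} {n : ℕ} → A → (Fin n → A) → Fin (sucℕ n) → A
extend x ρ fz     = x
extend x ρ (fs i) = ρ i

record Structure : Set₁ where
  field
    Word   : Set
    System : Set
    zero one : Word
    _∙_    : Word → Word → Word
    _∈_    : Word → System → Set

  evalT : ∀ {nw} → (Fin nw → Word) → Term nw → Word
  evalT ρ (var i) = ρ i
  evalT ρ 𝟘       = zero
  evalT ρ 𝟙       = one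
  evalT ρ (t · u) = evalT ρ t ∙ evalT ρ u

  ⟦_⟧ : ∀ {nw ns} → Formula nw ns → (Fin nw → Word) → (Fin ns → System) → Set
  ⟦ t ≐ u ⟧   ρ σ = evalT ρ t ≡ evalT ρ u
  ⟦ t ∈ₛ i ⟧  ρ σ = evalT ρ t ∈ σ i
  ⟦ i ≐ₛ j ⟧  ρ σ = σ i ≡ σ j
  ⟦ ⊥f ⟧      ρ σ = ⊥
  ⟦ φ ∧f ψ ⟧  ρ σ = ⟦ φ ⟧ ρ σ × ⟦ ψ ⟧ ρ σ
  ⟦ φ ∨f ψ ⟧  ρ σ = ⟦ φ ⟧ ρ σ ⊎ ⟦ ψ ⟧ ρ σ
  ⟦ φ ⇒f ψ ⟧  ρ σ = ⟦ φ ⟧ ρ σ → ⟦ ψ ⟧ ρ σ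
  ⟦ ¬f φ ⟧    ρ σ = ¬ ⟦ φ ⟧ ρ σ
  ⟦ ∀w φ ⟧    ρ σ = (x : Word) → ⟦ φ ⟧ (extend x ρ) σ
  ⟦ ∃w φ ⟧    ρ σ = Σ Word λ x → ⟦ φ ⟧ (extend x ρ) σ
  ⟦ ∀s φ ⟧    ρ σ = (S : System) → ⟦ φ ⟧ ρ (extend S σ)
  ⟦ ∃s φ ⟧    ρ σ = Σ System λ S → ⟦ φ ⟧ ρ (extend S σ)

-- Models of the theory (equality interpreted as identity).

record IsModel (M : Structure) : Set₁ where
  open Structure M
  field
    0≢1        : ¬ (zero ≡ one)
    ∙≢0        : ∀ x y → ¬ (x ∙ y ≡ zero)
    ∙≢1        : ∀ x y → ¬ (x ∙ y ≡ one)
    assoc      : ∀ x y z → (x ∙ y) ∙ z ≡ x ∙ (y ∙ z)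
    reading    : ∀ x y → ¬ (x ∙ zero ≡ y ∙ one)
    simplify   : ∀ x₁ y₁ x₂ y₂ → x₁ ∙ y₁ ≡ x₂ ∙ y₂ → y₁ ≡ y₂ → x₁ ≡ x₂
    ext        : ∀ S T → (∀ x → (x ∈ S → x ∈ T) × (x ∈ T → x ∈ S)) → S ≡ T
    induction  : ∀ S → zero ∈ S → one ∈ S →
                 (∀ x → x ∈ S → (x ∙ zero) ∈ S × (x ∙ one) ∈ S) →
                 ∀ x → x ∈ S
    -- comprehension schema: one instance per formula φ(x, x₁..xₙ, S₁..Sₘ)
    -- (S is not free in φ since it is not among φ's variables)
    comprehension : ∀ {n m} (φ : Formula (sucℕ n) m)
                    (ρ : Fin n → Word) (σ : Fin m → System) →
                    Σ System λ S → ∀ x → x ∈ S ⇔ ⟦ φ ⟧ (extend x ρ) σ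

module _ (M : Structure) where
  open Structure M

  IsAlphabet : System → Set
  IsAlphabet A = ∀ x y z₁ z₂ → z₁ ∈ A → z₂ ∈ A →
    (x ∙ z₁ ≡ y ∙ z₂ → z₁ ≡ z₂) × (z₁ ∙ x ≡ z₂ ∙ y → z₁ ≡ z₂)

  RightClosed : System → System → Set
  RightClosed A S = (∀ a → a ∈ A → a ∈ S) ×
                    (∀ x₁ x₂ → x₁ ∈ A → x₂ ∈ S → (x₂ ∙ x₁) ∈ S)

  -- w belongs to the smallest such system (i.e. to every such system)
  WordOver : System → Word → Set
  WordOver A w = ∀ S → RightClosed A S → w ∈ S

module Submission where

-- The proof has two independent halves.
--  * Every word over A ends in a letter: it is either a letter or of the
--    form u·a with a ∈ A.  The words of this shape form a system (by
--    comprehension) that contains A and is closed under right multiplication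
--    by letters, so it contains every word over A.  Consequently a product
--    w₁w₂ with w₂ over A can be written p·a with a ∈ A.
--  * A letter x is never of the form p·a with a ∈ A: multiplying by 0 on the
--    left gives 0x = (0p)a, so the alphabet property forces x = a, and then
--    right simplification of 0a = (0p)a yields 0 = 0p, which the symbol
--    axioms forbid.

open import Defs
open import Relation.Nullary using (¬_)
open import Relation.Binary.PropositionalEquality
  using (_≡_; refl; sym; trans; cong; module ≡-Reasoning)
open import Data.Fin using () renaming (zero to fz; suc to fs)
open import Data.Product using (Σ-syntax; _×_; _,_; proj₁; proj₂)
open import Data.Sum using (_⊎_; inj₁; inj₂)
open import Function.Bundles using (_⇔_; Equivalence)

module _ {M : Structure} (model : IsModel M) where
  open Structure M
  open IsModel model

  EndsInLetter : System → Word → Set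
  EndsInLetter A w = w ∈ A ⊎ (Σ[ u ∈ Word ] Σ[ a ∈ Word ] a ∈ A × w ≡ u ∙ a)

  -- The formula  x ∈ S₀ ∨ ∃u ∃a (a ∈ S₀ ∧ x = u·a)  defining EndsInLetter.
  endsInLetterFormula : Formula 1 1
  endsInLetterFormula =
    (var fz ∈ₛ fz) ∨f
    ∃w (∃w ((var fz ∈ₛ fz) ∧f (var (fs (fs fz)) ≐ (var (fs fz) · var fz))))

  -- Every word over A ends in a letter, since the system of such words
  -- (given by comprehension) is right-closed over A.
  wordOver⇒endsInLetter : ∀ A w → WordOver M A w → EndsInLetter A w
  wordOver⇒endsInLetter A w wordOver =
    Equivalence.to (membership w) (wordOver S rightClosed)
    where
    S : System
    S = proj₁ (comprehension endsInLetterFormula (λ ()) (λ _ → A))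

    membership : ∀ v → v ∈ S ⇔ EndsInLetter A v
    membership = proj₂ (comprehension endsInLetterFormula (λ ()) (λ _ → A))

    rightClosed : RightClosed M A S
    rightClosed =
        (λ a a∈A → Equivalence.from (membership a) (inj₁ a∈A))
      , (λ a u a∈A _ → Equivalence.from (membership (u ∙ a)) (inj₂ (u , a , a∈A , refl)))

  product-endsInLetter : ∀ A w₁ w₂ → EndsInLetter A w₂ →
    Σ[ p ∈ Word ] Σ[ a ∈ Word ] a ∈ A × w₁ ∙ w₂ ≡ p ∙ a
  product-endsInLetter A w₁ w₂ (inj₁ w₂∈A) = w₁ , w₂ , w₂∈A , refl
  product-endsInLetter A w₁ w₂ (inj₂ (u , a , a∈A , w₂≡ua)) =
    w₁ ∙ u , a , a∈A , (begin
      w₁ ∙ w₂        ≡⟨ cong (w₁ ∙_) w₂≡ua ⟩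
      w₁ ∙ (u ∙ a)   ≡⟨ sym (assoc w₁ u a) ⟩
      (w₁ ∙ u) ∙ a   ∎)
    where open ≡-Reasoning

  letter≢product : ∀ A → IsAlphabet M A → ∀ x p a → x ∈ A → a ∈ A →
    ¬ (x ≡ p ∙ a)
  letter≢product A alphabet x p a x∈A a∈A x≡pa =
    ∙≢0 zero p (sym (simplify zero a (zero ∙ p) a 0a≡[0p]a refl))
    where
    open ≡-Reasoning

    0x≡[0p]a : zero ∙ x ≡ (zero ∙ p) ∙ a
    0x≡[0p]a = begin
      zero ∙ x         ≡⟨ cong (zero ∙_) x≡pa ⟩
      zero ∙ (p ∙ a)   ≡⟨ sym (assoc zero p a) ⟩
      (zero ∙ p) ∙ a   ∎

    -- Letters are determined as right factors.
    x≡a : x ≡ a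
    x≡a = proj₁ (alphabet zero (zero ∙ p) x a x∈A a∈A) 0x≡[0p]a

    0a≡[0p]a : zero ∙ a ≡ (zero ∙ p) ∙ a
    0a≡[0p]a = begin
      zero ∙ a         ≡⟨ cong (zero ∙_) (sym x≡a) ⟩
      zero ∙ x         ≡⟨ 0x≡[0p]a ⟩
      (zero ∙ p) ∙ a   ∎

mainTheorem18 : (M : Structure) → IsModel M →
    let open Structure M in
    (A : System) → IsAlphabet M A → (x : Word) → x ∈ A →
    (w₁ w₂ : Word) → WordOver M A w₁ → WordOver M A w₂ →
    ¬ (x ≡ w₁ ∙ w₂)
mainTheorem18 M model A alphabet x x∈A w₁ w₂ _ w₂-over x≡w₁w₂
  with product-endsInLetter model A w₁ w₂
         (wordOver⇒endsInLetter model A w₂ w₂-over)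
... | p , a , a∈A , w₁w₂≡pa =
  letter≢product model A alphabet x p a x∈A a∈A (trans x≡w₁w₂ w₁w₂≡pa)
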